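{- Let $L$ be a finite atomistic lattice, and let $\xi$ and $\mathcal{T}_L=(\mathrm{At}(L),T_L)$ be as defined in the context. Then: (i) $x\xi$ is a flat of $\mathcal{T}_L$ for every $x\in L$; (ii) $\xi$ is injective and, for all $x,y\in L$, $x\le y$ if and only if $x\xi\subseteq y\xi$; thus $\xi$ is a lattice isomorphism of $L$ onto the subset $L\xi=\{x\xi\mid x\in L\}$ of $\mathrm{Fl}\,\mathcal{T}_L$ ordered by inclusion; (iii) $\mathcal{T}_L$ is boolean representable; (iv) $\mathcal{T}_L$ is simple.
   Context: For a finite lattice $L$, $\mathrm{At}(L)$ is its set of atoms (elements covering the bottom); $L$ is atomistic if every element is a join of atoms. For $x\in L$ let $x\xi=\{a\in\mathrm{At}(L)\mid a\le x\}$. A set $A\subseteq\mathrm{At}(L)$ is a transversal of a chain in $L$ if there are an enumeration $a_1,\dots,a_m$ of the elements of $A$ and a chain $x_0<x_1<\cdots<x_m$ in $L$ with $a_i\in x_i\xi\setminus x_{i-1}\xi$ for $i=1,\dots,m$. $T_L\subseteq 2^{\mathrm{At}(L)}$ is the set of all such transversals, and $\mathcal{T}_L=(\mathrm{At}(L),T_L)$; it is a simplicial complex (a pair $(V,H)$ with $H\subseteq 2^V$ nonempty and closed under subsets). A subset $X\subseteq V$ is a flat of $(V,H)$ if for every $I\in H$ with $I\subseteq X$ and every $p\in V\setminus X$ we have $I\cup\{p\}\in H$; the flats ordered by inclusion form the lattice $\mathrm{Fl}$. A set $X$ is a transversal of the successive differences for a chain of subsets $A_0\subset\cdots\subset A_k$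 if $X$ has an enumeration $x_1,\dots,x_k$ with $x_i\in A_i\setminus A_{i-1}$; $(V,H)$ is boolean representable if every $X\in H$ is such a transversal for some chain of flats. $(V,H)$ is simple if every subset of $V$ with at most two elements belongs to $H$. -}

module Defs where

open import Level using (0ℓ)
open import Data.Nat using (ℕ; suc)
import Data.Nat as ℕ
open import Data.Bool using (Bool; _∧_)
open import Data.Fin using (Fin; inject₁) renaming (suc to fsuc)
open import Data.Fin.Properties using (all?; _≟_)
open import Data.Fin.Subset using (Subset; _∈_; _∉_; _⊆_; _⊂_; _∪_; ⁅_⁆; ∣_∣)
open import Data.Vec using (tabulate)
open import Data.Product using (Σ; ∃; _×_; _,_)
open import Relation.Binary.Core using (Rel)
open import Relation.Binary.Definitions using (Decidable; Minimum)
open import Relation.Binary.PropositionalEquality using (_≡_; _≢_)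
open import Relation.Binary.Lattice.Structures using (IsLattice)
open import Relation.Nullary using (¬_; Dec; ¬?; isYes)
open import Relation.Nullary.Decidable using (_×-dec_)
open import Algebra.Core using (Op₂)

-- Finite lattices, represented on the carrier Fin n (every finite lattice
-- is isomorphic to one of this form).
-- A finite (nonempty) lattice always has a least element; we record it.
-- The order is assumed decidable (automatic classically for a finite relation).

record FiniteLattice : Set₁ where
  infix 4 _≤_
  field
    n         : ℕ
    _≤_       : Rel (Fin n) 0ℓ
    _∨_       : Op₂ (Fin n)
    _∧L_      : Op₂ (Fin n)
    isLattice : IsLattice _≡_ _≤_ _∨_ _∧L_
    ⊥         : Fin n
    ⊥-minimum : Minimum _≤_ ⊥
    _≤?_      : Decidable _≤_

module _ {n : ℕ} where

  IsEnumeration : {m : ℕ} → (Fin m → Fin n) → Subset n → Set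
  IsEnumeration {m} e A =
    (∀ i j → e i ≡ e j → i ≡ j) × (∀ i → e i ∈ A) × (∀ a → a ∈ A → ∃ λ i → e i ≡ a)

  IsFlat : Subset n → (Subset n → Set) → Subset n → Set
  IsFlat V H X =
    X ⊆ V × (∀ I → H I → I ⊆ X → ∀ p → p ∈ V → p ∉ X → H (I ∪ ⁅ p ⁆))

  IsTransversalOfSuccDiffs : {k : ℕ} → Subset n → (Fin (suc k) → Subset n) → Set
  IsTransversalOfSuccDiffs {k} X A =
    (∀ (i : Fin k) → A (inject₁ i) ⊂ A (fsuc i)) ×
    (Σ (Fin k → Fin n) λ e → IsEnumeration e X ×
       (∀ i → e i ∈ A (fsuc i) × e i ∉ A (inject₁ i)))

  BooleanRepresentable : Subset n → (Subset n → Set) → Set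
  BooleanRepresentable V H =
    ∀ X → H X → ∃ λ k → Σ (Fin (suc k) → Subset n) λ A →
      (∀ i → IsFlat V H (A i)) × IsTransversalOfSuccDiffs X A

  IsSimple : Subset n → (Subset n → Set) → Set
  IsSimple V H = ∀ X → X ⊆ V → ∣ X ∣ ℕ.≤ 2 → H X

module _ (L : FiniteLattice) where
  open FiniteLattice L

  infix 4 _<_
  _<_ : Rel (Fin n) 0ℓ
  x < y = x ≤ y × x ≢ y

  _<?_ : Decidable _<_
  x <? y = (x ≤? y) ×-dec ¬? (x ≟ y)

  IsAtom : Fin n → Set
  IsAtom a = ⊥ < a × (∀ z → ¬ (⊥ < z × z < a))

  atom? : (a : Fin n) → Dec (IsAtom a)
  atom? a = (⊥ <? a) ×-dec all? (λ z → ¬? ((⊥ <? z) ×-dec (z <? a)))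

  At : Subset n
  At = tabulate (λ a → isYes (atom? a))

  ξ : Fin n → Subset n
  ξ x = tabulate (λ a → isYes (atom? a) ∧ isYes (a ≤? x))

  IsJoinOf : Fin n → Subset n → Set
  IsJoinOf x S = (∀ s → s ∈ S → s ≤ x) × (∀ u → (∀ s → s ∈ S → s ≤ u) → x ≤ u)

  Atomistic : Set
  Atomistic = ∀ x → ∃ λ S → S ⊆ At × IsJoinOf x S

  T : Subset n → Set
  T A = ∃ λ m → Σ (Fin m → Fin n) λ e → Σ (Fin (suc m) → Fin n) λ c →
    IsEnumeration e A ×
    (∀ i → c (inject₁ i) < c (fsuc i)) ×
    (∀ i → e i ∈ ξ (c (fsuc i)) × e i ∉ ξ (c (inject₁ i)))

-- Everything rests on one construction: if I ⊆ xξ is the transversal of a chain c₀ < ⋯ < cₘ and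
-- p is an atom outside xξ, then c₀ ∧ x ≤ ⋯ ≤ cₘ ∧ x ≤ x ∨ p is again a chain with transversal
-- I ∪ {p}, so xξ is a flat.  The ξ-images of any witnessing chain are then flats whose successive
-- differences I traverses (boolean representability); two distinct atoms a, b are a transversal
-- of ⊥ < a < a ∨ b (simplicity); and atomisticity makes ξ an order embedding.
module Submission where

open import Defs
open import Data.Product using (_×_; Σ; ∃; _,_; proj₁; proj₂)
open import Data.Fin.Subset using (_⊆_)
open import Relation.Binary.PropositionalEquality using (_≡_; refl; sym; trans; cong; subst)

open import Data.Nat using (ℕ; zero; suc; s≤s)
import Data.Nat as ℕ
open import Data.Bool as Bool using (Bool)
open import Data.Bool.Properties using (T-≡; T-∧)
open import Data.Fin using (Fin; inject₁; fromℕ) renaming (zero to fzero; suc to fsuc)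
open import Data.Fin.Properties using (suc-injective; _≟_)
open import Data.Fin.Subset using (Subset; outside; inside; _∈_; _∉_; _∪_; ⁅_⁆; ∣_∣)
open import Data.Fin.Subset.Properties using (x∈⁅x⁆; x∈⁅y⁆⇒x≡y; x∈p∪q⁻; p⊆p∪q; q⊆p∪q)
open import Data.Vec using ([]; _∷_; tabulate; here; there)
open import Data.Vec.Properties using (lookup∘tabulate; []=⇒lookup; lookup⇒[]=)
open import Data.Vec.Functional as Vector using (head; tail)
open import Data.Sum using (inj₁; inj₂)
open import Function using (_∘_)
open import Function.Bundles using (Equivalence)
open import Relation.Binary.Lattice.Structures using (IsLattice)
open import Relation.Nullary using (yes; no; contradiction)
open import Relation.Nullary.Decidable using (toWitness; fromWitness)

_∷ʳ_ : {A : Set} {m : ℕ} → (Fin m → A) → A → Fin (suc m) → A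
_∷ʳ_ {m = zero}  f a = a Vector.∷ Vector.[]
_∷ʳ_ {m = suc m} f a = head f Vector.∷ (tail f ∷ʳ a)

∷ʳ-inject₁ : {A : Set} {m : ℕ} (f : Fin m → A) (a : A) (i : Fin m) → (f ∷ʳ a) (inject₁ i) ≡ f i
∷ʳ-inject₁ f a fzero    = refl
∷ʳ-inject₁ f a (fsuc i) = ∷ʳ-inject₁ (tail f) a i

∷ʳ-fromℕ : {A : Set} {m : ℕ} (f : Fin m → A) (a : A) → (f ∷ʳ a) (fromℕ m) ≡ a
∷ʳ-fromℕ {m = zero}  f a = refl
∷ʳ-fromℕ {m = suc m} f a = ∷ʳ-fromℕ (tail f) a

∷ʳ-steps : {A B : Set} (P : A → B → B → Set) {m : ℕ} {f : Fin m → A} (c : Fin (suc m) → B) {a : A} {y : B} →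
  (∀ i → P (f i) (c (inject₁ i)) (c (fsuc i))) → P a (c (fromℕ m)) y →
  ∀ i → P ((f ∷ʳ a) i) ((c ∷ʳ y) (inject₁ i)) ((c ∷ʳ y) (fsuc i))
∷ʳ-steps P {zero}  c steps top fzero    = top
∷ʳ-steps P {suc m} c steps top fzero    = steps fzero
∷ʳ-steps P {suc m} c steps top (fsuc i) = ∷ʳ-steps P (tail c) (steps ∘ fsuc) top i

data InjectOrLast {m : ℕ} : Fin (suc m) → Set where
  inject : (i : Fin m) → InjectOrLast (inject₁ i)
  last   : InjectOrLast (fromℕ m)

injectOrLast : {m : ℕ} (i : Fin (suc m)) → InjectOrLast i
injectOrLast {zero}  fzero    = last
injectOrLast {suc m} fzero    = inject fzero
injectOrLast {suc m} (fsuc i) with injectOrLast i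
... | inject j = inject (fsuc j)
... | last     = last

∈-tabulate⁺ : {n : ℕ} {f : Fin n → Bool} {a : Fin n} → Bool.T (f a) → a ∈ tabulate f
∈-tabulate⁺ {f = f} {a} t = lookup⇒[]= a (tabulate f) (trans (lookup∘tabulate f a) (Equivalence.to T-≡ t))

∈-tabulate⁻ : {n : ℕ} {f : Fin n → Bool} {a : Fin n} → a ∈ tabulate f → Bool.T (f a)
∈-tabulate⁻ {f = f} {a} a∈ = Equivalence.from T-≡ (trans (sym (lookup∘tabulate f a)) ([]=⇒lookup a∈))

module _ {n : ℕ} where

  IsEnumeration-∷ʳ : {m : ℕ} {e : Fin m → Fin n} {A : Subset n} {p : Fin n} →
    IsEnumeration e A → p ∉ A → IsEnumeration (e ∷ʳ p) (A ∪ ⁅ p ⁆)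
  IsEnumeration-∷ʳ {m} {e} {A} {p} (injective , member , onto) p∉A = injective′ , member′ , onto′
    where
    injective′ : ∀ i j → (e ∷ʳ p) i ≡ (e ∷ʳ p) j → i ≡ j
    injective′ i j eq with injectOrLast i | injectOrLast j
    ... | inject i′ | inject j′ = cong inject₁ (injective i′ j′
            (trans (sym (∷ʳ-inject₁ e p i′)) (trans eq (∷ʳ-inject₁ e p j′))))
    ... | inject i′ | last      = contradiction (subst (_∈ A)
            (trans (sym (∷ʳ-inject₁ e p i′)) (trans eq (∷ʳ-fromℕ e p))) (member i′)) p∉A
    ... | last      | inject j′ = contradiction (subst (_∈ A)
            (trans (sym (∷ʳ-inject₁ e p j′)) (trans (sym eq) (∷ʳ-fromℕ e p))) (member j′)) p∉A
    ... | last      | last      = refl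

    member′ : ∀ i → (e ∷ʳ p) i ∈ A ∪ ⁅ p ⁆
    member′ i with injectOrLast i
    ... | inject i′ = subst (_∈ A ∪ ⁅ p ⁆) (sym (∷ʳ-inject₁ e p i′)) (p⊆p∪q ⁅ p ⁆ (member i′))
    ... | last      = subst (_∈ A ∪ ⁅ p ⁆) (sym (∷ʳ-fromℕ e p)) (q⊆p∪q A ⁅ p ⁆ (x∈⁅x⁆ p))

    onto′ : ∀ a → a ∈ A ∪ ⁅ p ⁆ → ∃ λ i → (e ∷ʳ p) i ≡ a
    onto′ a a∈ with x∈p∪q⁻ A ⁅ p ⁆ a∈
    ... | inj₁ a∈A = let i , eᵢ≡a = onto a a∈A in inject₁ i , trans (∷ʳ-inject₁ e p i) eᵢ≡a
    ... | inj₂ a∈p = fromℕ m , trans (∷ʳ-fromℕ e p) (sym (x∈⁅y⁆⇒x≡y p a∈p))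

  IsEnumeration-outside : {m : ℕ} {e : Fin m → Fin n} {X : Subset n} →
    IsEnumeration e X → IsEnumeration (fsuc ∘ e) (outside ∷ X)
  IsEnumeration-outside {e = e} {X} (injective , member , onto) =
    (λ i j → injective i j ∘ suc-injective) , there ∘ member , onto′
    where
    onto′ : ∀ a → a ∈ outside ∷ X → ∃ λ i → fsuc (e i) ≡ a
    onto′ (fsuc a) (there a∈X) = let i , eᵢ≡a = onto a a∈X in i , cong fsuc eᵢ≡a

  IsEnumeration-inside : {m : ℕ} {e : Fin m → Fin n} {X : Subset n} →
    IsEnumeration e X → IsEnumeration (fzero Vector.∷ (fsuc ∘ e)) (inside ∷ X)
  IsEnumeration-inside {e = e} {X} (injective , member , onto) = injective′ , member′ , onto′
    where
    e′ : Fin _ → Fin (suc n)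
    e′ = fzero Vector.∷ (fsuc ∘ e)

    injective′ : ∀ i j → e′ i ≡ e′ j → i ≡ j
    injective′ fzero    fzero    _  = refl
    injective′ (fsuc i) (fsuc j) eq = cong fsuc (injective i j (suc-injective eq))

    member′ : ∀ i → e′ i ∈ inside ∷ X
    member′ fzero    = here
    member′ (fsuc i) = there (member i)

    onto′ : ∀ a → a ∈ inside ∷ X → ∃ λ i → e′ i ≡ a
    onto′ fzero    _           = fzero , refl
    onto′ (fsuc a) (there a∈X) = let i , eᵢ≡a = onto a a∈X in fsuc i , cong fsuc eᵢ≡a

enumerate : {n : ℕ} (X : Subset n) → Σ (Fin ∣ X ∣ → Fin n) λ e → IsEnumeration e X
enumerate []            = (λ ()) , (λ ()) , (λ ()) , (λ _ ())
enumerate (outside ∷ X) = let e , isEnum = enumerate X in fsuc ∘ e , IsEnumeration-outside isEnum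
enumerate (inside ∷ X)  = let e , isEnum = enumerate X in _ , IsEnumeration-inside isEnum

module _ (L : FiniteLattice) where
  open FiniteLattice L
  open IsLattice isLattice
    using (antisym; x≤x∨y; y≤x∨y; x∧y≤x; x∧y≤y; ∧-greatest) renaming (refl to ≤-refl; trans to ≤-trans)

  ∈At⁺ : ∀ {a} → IsAtom L a → a ∈ At L
  ∈At⁺ isAtom = ∈-tabulate⁺ (fromWitness isAtom)

  ∈At⁻ : ∀ {a} → a ∈ At L → IsAtom L a
  ∈At⁻ {a} a∈At = toWitness {a? = atom? L a} (∈-tabulate⁻ a∈At)

  ∈ξ⁺ : ∀ {a x} → IsAtom L a → a ≤ x → a ∈ ξ L x
  ∈ξ⁺ {a} {x} isAtom a≤x = ∈-tabulate⁺ (Equivalence.from T-∧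
    (fromWitness {a? = atom? L a} isAtom , fromWitness {a? = a ≤? x} a≤x))

  ∈ξ⁻ : ∀ {a x} → a ∈ ξ L x → IsAtom L a × a ≤ x
  ∈ξ⁻ {a} {x} a∈ξx =
    let isAtom , a≤x = Equivalence.to T-∧ (∈-tabulate⁻ a∈ξx)
    in toWitness {a? = atom? L a} isAtom , toWitness {a? = a ≤? x} a≤x

  ξ⊆At : ∀ x → ξ L x ⊆ At L
  ξ⊆At x = ∈At⁺ ∘ proj₁ ∘ ∈ξ⁻

  ξ-mono : ∀ {x y} → x ≤ y → ξ L x ⊆ ξ L y
  ξ-mono x≤y a∈ξx = let isAtom , a≤x = ∈ξ⁻ a∈ξx in ∈ξ⁺ isAtom (≤-trans a≤x x≤y)

  ∉ξ⊥ : ∀ {a} → a ∉ ξ L ⊥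
  ∉ξ⊥ a∈ξ⊥ = let (⊥<a , _) , a≤⊥ = ∈ξ⁻ a∈ξ⊥ in proj₂ ⊥<a (antisym (⊥-minimum _) a≤⊥)

  atom≤atom⇒≡ : ∀ {a b} → IsAtom L a → IsAtom L b → b ≤ a → b ≡ a
  atom≤atom⇒≡ {a} {b} isAtomA isAtomB b≤a with b ≟ a
  ... | yes b≡a = b≡a
  ... | no  b≢a = contradiction (proj₁ isAtomB , b≤a , b≢a) (proj₂ isAtomA b)

  module _ (atomistic : Atomistic L) where

    ξ-reflects-≤ : ∀ x y → ξ L x ⊆ ξ L y → x ≤ y
    ξ-reflects-≤ x y ξx⊆ξy =
      let S , S⊆At , upper , least = atomistic x
      in least y (λ s s∈S → proj₂ (∈ξ⁻ (ξx⊆ξy (∈ξ⁺ (∈At⁻ (S⊆At s∈S)) (upper s s∈S)))))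

    ξ-injective : ∀ x y → ξ L x ≡ ξ L y → x ≡ y
    ξ-injective x y ξx≡ξy = antisym (ξ-reflects-≤ x y (subst (_ ∈_) ξx≡ξy))
                                     (ξ-reflects-≤ y x (subst (_ ∈_) (sym ξx≡ξy)))

  -- Only u ≤ v is asked for: the atom a separating v from u already forces u < v.
  Step : Fin n → Fin n → Fin n → Set
  Step a u v = u ≤ v × a ∈ ξ L v × a ∉ ξ L u

  Step⇒< : ∀ {a u v} → Step a u v → _<_ L u v
  Step⇒< (u≤v , a∈ξv , a∉ξu) = u≤v , λ u≡v → a∉ξu (subst (λ w → _ ∈ ξ L w) (sym u≡v) a∈ξv)

  Step-⊥ : ∀ {a} → IsAtom L a → Step a ⊥ a
  Step-⊥ isAtom = ⊥-minimum _ , ∈ξ⁺ isAtom ≤-refl , ∉ξ⊥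

  Step-∧ : ∀ {a u v x} → a ≤ x → Step a u v → Step a (u ∧L x) (v ∧L x)
  Step-∧ {u = u} {v} {x} a≤x (u≤v , a∈ξv , a∉ξu) =
    let isAtom , a≤v = ∈ξ⁻ a∈ξv
    in ∧-greatest (≤-trans (x∧y≤x u x) u≤v) (x∧y≤y u x) ,
       ∈ξ⁺ isAtom (∧-greatest a≤v a≤x) ,
       a∉ξu ∘ ξ-mono (x∧y≤x u x)

  T-intro : ∀ {m A} {e : Fin m → Fin n} (c : Fin (suc m) → Fin n) → IsEnumeration e A →
    (∀ i → Step (e i) (c (inject₁ i)) (c (fsuc i))) → T L A
  T-intro c isEnum steps = _ , _ , c , isEnum , Step⇒< ∘ steps , proj₂ ∘ steps

  ξ-isFlat : ∀ x → IsFlat (At L) (T L) (ξ L x)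
  ξ-isFlat x = ξ⊆At x , extend
    where
    extend : ∀ I → T L I → I ⊆ ξ L x → ∀ p → p ∈ At L → p ∉ ξ L x → T L (I ∪ ⁅ p ⁆)
    extend I (m , e , c , isEnum@(_ , member , _) , chain , separated) I⊆ξx p p∈At p∉ξx =
      T-intro ((λ i → c i ∧L x) ∷ʳ (x ∨ p)) (IsEnumeration-∷ʳ isEnum (p∉ξx ∘ I⊆ξx))
        (∷ʳ-steps Step (λ i → c i ∧L x) below top)
      where
      below : ∀ i → Step (e i) (c (inject₁ i) ∧L x) (c (fsuc i) ∧L x)
      below i = Step-∧ (proj₂ (∈ξ⁻ (I⊆ξx (member i)))) (proj₁ (chain i) , separated i)

      top : Step p (c (fromℕ m) ∧L x) (x ∨ p)
      top = ≤-trans (x∧y≤y _ x) (x≤x∨y x p) , ∈ξ⁺ (∈At⁻ p∈At) (y≤x∨y x p) , p∉ξx ∘ ξ-mono (x∧y≤y _ x)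

  T-booleanRepresentable : BooleanRepresentable (At L) (T L)
  T-booleanRepresentable X (m , e , c , isEnum , chain , separated) =
    m , ξ L ∘ c , ξ-isFlat ∘ c ,
    (λ i → ξ-mono (proj₁ (chain i)) , e i , separated i) , e , isEnum , separated

  T-small : ∀ {k X} → k ℕ.≤ 2 → (e : Fin k → Fin n) → IsEnumeration e X → X ⊆ At L → T L X
  T-small {zero}              _ e isEnum _ = T-intro (λ _ → ⊥) isEnum (λ ())
  T-small {suc zero}          _ e isEnum@(_ , member , _) X⊆At =
    T-intro (⊥ Vector.∷ e fzero Vector.∷ Vector.[]) isEnum λ { fzero → Step-⊥ (∈At⁻ (X⊆At (member fzero))) }
  T-small {suc (suc zero)}    _ e isEnum@(injective , member , _) X⊆At =
    T-intro (⊥ Vector.∷ a Vector.∷ (a ∨ b) Vector.∷ Vector.[]) isEnum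
      λ { fzero → Step-⊥ isAtomA ; (fsuc fzero) → x≤x∨y a b , ∈ξ⁺ isAtomB (y≤x∨y a b) , b∉ξa }
    where
    a b : Fin n
    a = e fzero
    b = e (fsuc fzero)
    isAtomA : IsAtom L a
    isAtomA = ∈At⁻ (X⊆At (member fzero))
    isAtomB : IsAtom L b
    isAtomB = ∈At⁻ (X⊆At (member (fsuc fzero)))
    b∉ξa : b ∉ ξ L a
    b∉ξa b∈ξa with injective (fsuc fzero) fzero (atom≤atom⇒≡ isAtomA isAtomB (proj₂ (∈ξ⁻ b∈ξa)))
    ... | ()
  T-small {suc (suc (suc _))} (s≤s (s≤s ())) _ _ _

  T-isSimple : IsSimple (At L) (T L)
  T-isSimple X X⊆At ∣X∣≤2 = let e , isEnum = enumerate X in T-small ∣X∣≤2 e isEnum X⊆At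

lemma5p1 : (L : FiniteLattice) → Atomistic L →
    (∀ x → IsFlat (At L) (T L) (ξ L x)) ×
    ((∀ x y → ξ L x ≡ ξ L y → x ≡ y) ×
     (∀ x y → (FiniteLattice._≤_ L x y → ξ L x ⊆ ξ L y) × (ξ L x ⊆ ξ L y → FiniteLattice._≤_ L x y))) ×
    BooleanRepresentable (At L) (T L) ×
    IsSimple (At L) (T L)
lemma5p1 L atomistic =
  ξ-isFlat L ,
  (ξ-injective L atomistic , λ x y → ξ-mono L , ξ-reflects-≤ L atomistic x y) ,
  T-booleanRepresentable L ,
  T-isSimple L
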